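{- Let $\vdash$ be either classical or intuitionistic propositional derivability, let $A\in\mathcal{L}$ and let $U$ be the uniform post-interpolant of $A$ with respect to ${\sf par}$. Every projective unifier of $A\leftrightarrow U$ is also a projective $U$-fier of $A$ (i.e. a substitution $\theta$ with $\vdash\theta(A)\leftrightarrow U$ and $A\vdash\theta(a)\leftrightarrow a$ for all atoms $a$). Consequently, if $A\leftrightarrow U$ is projective then $A$ is ${\sf par}$-projective.
   Context: The language $\mathcal{L}$ is built from atoms ${\sf var}\cup{\sf par}$ (variables and parameters, disjoint infinite sets) using $\bot,\wedge,\vee,\to$; $\top:=\bot\to\bot$. $\mathcal{L}({\sf par})$ is the set of formulas whose atoms are all parameters. A substitution is a map $\theta:\mathcal{L}\to\mathcal{L}$ commuting with connectives with $\theta(p)=p$ for $p\in{\sf par}$. The uniform post-interpolant $U$ of $A$ w.r.t. ${\sf par}$ is $U\in\mathcal{L}({\sf par})$ with $\vdash A\to U$ and $\vdash U\to C$ for every $C\in\mathcal{L}({\sf par})$ with $\vdash A\to C$ (assumed to exist). A projective unifier of $B$ is $\theta$ with $\vdash\theta(B)$ and $B\vdash\theta(a)\leftrightarrow a$ for all atoms $a$; $B$ is projective if it has one. $A$ is ${\sf par}$-projective if for some $E\in\mathcal{L}({\sf par})$ there is $\theta$ with $\vdash\theta(A)\leftrightarrow E$ and $A\vdash\theta(a)\leftrightarrow a$ for all atoms $a$. -}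

module Defs where

open import Data.Nat using (ℕ)
open import Data.List using (List; []; _∷_)
open import Data.List.Membership.Propositional using (_∈_)
open import Data.Product using (Σ; _×_)

infixr 6 _∧'_
infixr 5 _∨'_
infixr 4 _⇒_
data Fm : Set where
  var  : ℕ → Fm
  par  : ℕ → Fm
  ⊥'   : Fm
  _∧'_ : Fm → Fm → Fm
  _∨'_ : Fm → Fm → Fm
  _⇒_  : Fm → Fm → Fm

⊤' : Fm
⊤' = ⊥' ⇒ ⊥'

infix 3 _⇔_
_⇔_ : Fm → Fm → Fm
A ⇔ B = (A ⇒ B) ∧' (B ⇒ A)

data Atom : Set where
  v : ℕ → Atom
  p : ℕ → Atom

atom : Atom → Fm
atom (v n) = var n
atom (p n) = par n

data InPar : Fm → Set where
  par  : ∀ n → InPar (par n)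
  ⊥'   : InPar ⊥'
  _∧'_ : ∀ {A B} → InPar A → InPar B → InPar (A ∧' B)
  _∨'_ : ∀ {A B} → InPar A → InPar B → InPar (A ∨' B)
  _⇒_  : ∀ {A B} → InPar A → InPar B → InPar (A ⇒ B)

Subst : Set
Subst = ℕ → Fm

sub : Subst → Fm → Fm
sub θ (var n)  = θ n
sub θ (par n)  = par n
sub θ ⊥'       = ⊥'
sub θ (A ∧' B) = sub θ A ∧' sub θ B
sub θ (A ∨' B) = sub θ A ∨' sub θ B
sub θ (A ⇒ B)  = sub θ A ⇒ sub θ B

data Logic : Set where
  int cl : Logic

infix 2 _⊢[_]_
data _⊢[_]_ : List Fm → Logic → Fm → Set where
  hyp  : ∀ {Γ L A} → A ∈ Γ → Γ ⊢[ L ] A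
  ⊥E   : ∀ {Γ L A} → Γ ⊢[ L ] ⊥' → Γ ⊢[ L ] A
  ∧I   : ∀ {Γ L A B} → Γ ⊢[ L ] A → Γ ⊢[ L ] B → Γ ⊢[ L ] A ∧' B
  ∧E₁  : ∀ {Γ L A B} → Γ ⊢[ L ] A ∧' B → Γ ⊢[ L ] A
  ∧E₂  : ∀ {Γ L A B} → Γ ⊢[ L ] A ∧' B → Γ ⊢[ L ] B
  ∨I₁  : ∀ {Γ L A B} → Γ ⊢[ L ] A → Γ ⊢[ L ] A ∨' B
  ∨I₂  : ∀ {Γ L A B} → Γ ⊢[ L ] B → Γ ⊢[ L ] A ∨' B
  ∨E   : ∀ {Γ L A B C} → Γ ⊢[ L ] A ∨' B → (A ∷ Γ) ⊢[ L ] C → (B ∷ Γ) ⊢[ L ] C → Γ ⊢[ L ] C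
  ⇒I   : ∀ {Γ L A B} → (A ∷ Γ) ⊢[ L ] B → Γ ⊢[ L ] A ⇒ B
  ⇒E   : ∀ {Γ L A B} → Γ ⊢[ L ] A ⇒ B → Γ ⊢[ L ] A → Γ ⊢[ L ] B
  raa  : ∀ {Γ A} → ((A ⇒ ⊥') ∷ Γ) ⊢[ cl ] ⊥' → Γ ⊢[ cl ] A

infix 2 ⊢[_]_
⊢[_]_ : Logic → Fm → Set
⊢[ L ] A = [] ⊢[ L ] A

IsUniformPostInterpolant : Logic → Fm → Fm → Set
IsUniformPostInterpolant L A U =
  InPar U × (⊢[ L ] A ⇒ U) ×
  (∀ C → InPar C → ⊢[ L ] A ⇒ C → ⊢[ L ] U ⇒ C)

IsProjectiveUnifier : Logic → Fm → Subst → Set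
IsProjectiveUnifier L B θ =
  (⊢[ L ] sub θ B) × (∀ a → (B ∷ []) ⊢[ L ] sub θ (atom a) ⇔ atom a)

Projective : Logic → Fm → Set
Projective L B = Σ Subst (IsProjectiveUnifier L B)

IsProjectiveFier : Logic → Fm → Fm → Subst → Set
IsProjectiveFier L A E θ =
  (⊢[ L ] sub θ A ⇔ E) × (∀ a → (A ∷ []) ⊢[ L ] sub θ (atom a) ⇔ atom a)

ParProjective : Logic → Fm → Set
ParProjective L A = Σ Fm λ E → InPar E × Σ Subst (IsProjectiveFier L A E)

-- A projective unifier θ of A ⇔ U proves θ(A) ⇔ θ(U), and θ fixes U because U
-- contains only parameters. Its locality A ⇔ U ⊢ θ(a) ⇔ a transfers to A ⊢ θ(a) ⇔ a,
-- since ⊢ A ⇒ U makes A ⇔ U derivable from A alone.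
module Submission where

open import Defs
open import Data.Product using (_×_; _,_)
open import Data.List using (List; []; _∷_)
open import Data.List.Membership.Propositional using (_∈_)
open import Data.List.Relation.Unary.Any using (here; there)
open import Relation.Binary.PropositionalEquality using (_≡_; refl; cong₂; subst)

sub-InPar : (θ : Subst) {U : Fm} → InPar U → sub θ U ≡ U
sub-InPar θ (par n)  = refl
sub-InPar θ ⊥'       = refl
sub-InPar θ (B ∧' C) = cong₂ _∧'_ (sub-InPar θ B) (sub-InPar θ C)
sub-InPar θ (B ∨' C) = cong₂ _∨'_ (sub-InPar θ B) (sub-InPar θ C)
sub-InPar θ (B ⇒ C)  = cong₂ _⇒_ (sub-InPar θ B) (sub-InPar θ C)

_⊆_ : List Fm → List Fm → Set
Γ ⊆ Δ = ∀ {X} → X ∈ Γ → X ∈ Δ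

∷-⊆ : ∀ {Γ Δ} {A : Fm} → Γ ⊆ Δ → (A ∷ Γ) ⊆ (A ∷ Δ)
∷-⊆ Γ⊆Δ (here eq)  = here eq
∷-⊆ Γ⊆Δ (there X∈) = there (Γ⊆Δ X∈)

weaken : ∀ {Γ Δ L X} → Γ ⊆ Δ → Γ ⊢[ L ] X → Δ ⊢[ L ] X
weaken Γ⊆Δ (hyp X∈) = hyp (Γ⊆Δ X∈)
weaken Γ⊆Δ (⊥E d) = ⊥E (weaken Γ⊆Δ d)
weaken Γ⊆Δ (∧I d e) = ∧I (weaken Γ⊆Δ d) (weaken Γ⊆Δ e)
weaken Γ⊆Δ (∧E₁ d) = ∧E₁ (weaken Γ⊆Δ d)
weaken Γ⊆Δ (∧E₂ d) = ∧E₂ (weaken Γ⊆Δ d)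
weaken Γ⊆Δ (∨I₁ d) = ∨I₁ (weaken Γ⊆Δ d)
weaken Γ⊆Δ (∨I₂ d) = ∨I₂ (weaken Γ⊆Δ d)
weaken Γ⊆Δ (∨E d e f) = ∨E (weaken Γ⊆Δ d) (weaken (∷-⊆ Γ⊆Δ) e) (weaken (∷-⊆ Γ⊆Δ) f)
weaken Γ⊆Δ (⇒I d) = ⇒I (weaken (∷-⊆ Γ⊆Δ) d)
weaken Γ⊆Δ (⇒E d e) = ⇒E (weaken Γ⊆Δ d) (weaken Γ⊆Δ e)
weaken Γ⊆Δ (raa d) = raa (weaken (∷-⊆ Γ⊆Δ) d)

weaken-theorem : ∀ {Γ L X} → ⊢[ L ] X → Γ ⊢[ L ] X
weaken-theorem = weaken (λ ())

cut : ∀ {Γ L B X} → (B ∷ Γ) ⊢[ L ] X → Γ ⊢[ L ] B → Γ ⊢[ L ] X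
cut B⊢X Γ⊢B = ⇒E (⇒I B⊢X) Γ⊢B

⇔-from-⇒ : ∀ {L A U} → ⊢[ L ] A ⇒ U → (A ∷ []) ⊢[ L ] A ⇔ U
⇔-from-⇒ ⊢A⇒U =
  ∧I (⇒I (⇒E (weaken-theorem ⊢A⇒U) (hyp (here refl))))
     (⇒I (hyp (there (here refl))))

projectiveUnifier⇒projectiveFier : ∀ {L A U} θ → InPar U → ⊢[ L ] A ⇒ U →
  IsProjectiveUnifier L (A ⇔ U) θ → IsProjectiveFier L A U θ
projectiveUnifier⇒projectiveFier {L} {A} θ U∈par ⊢A⇒U (⊢θ[A⇔U] , local) =
  subst (λ W → ⊢[ L ] sub θ A ⇔ W) (sub-InPar θ U∈par) ⊢θ[A⇔U] ,
  λ a → cut (weaken (∷-⊆ (λ ())) (local a)) (⇔-from-⇒ ⊢A⇒U)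

lemma2p3 : (L : Logic) (A U : Fm) → IsUniformPostInterpolant L A U →
    ((θ : Subst) → IsProjectiveUnifier L (A ⇔ U) θ → IsProjectiveFier L A U θ)
    × (Projective L (A ⇔ U) → ParProjective L A)
lemma2p3 L A U (U∈par , ⊢A⇒U , _) = fier , par-projective
  where
    fier : (θ : Subst) → IsProjectiveUnifier L (A ⇔ U) θ → IsProjectiveFier L A U θ
    fier θ = projectiveUnifier⇒projectiveFier θ U∈par ⊢A⇒U

    par-projective : Projective L (A ⇔ U) → ParProjective L A
    par-projective (θ , unifier) = U , U∈par , θ , fier θ unifier
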